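{- For every set $\Gamma\cup\{\varphi\}$ of formulas of $\mathrm{FL}^B_{ew}$, $\Gamma\vdash\varphi$ in $\mathrm{FL}^B_{ew}$ if and only if for every $\mathbf{A}\in\mathbb{RL}^B$ and every $\mathbf{A}$-evaluation $e$, $e(\varphi)=1$ whenever $e[\Gamma]\subseteq\{1\}$.
   Context: Residuated lattice: algebra $(A;\wedge,\vee,\cdot,\to,0,1)$ with $(A;\wedge,\vee,0,1)$ a bounded lattice ($0$ least, $1$ greatest), $(A;\cdot,1)$ a commutative monoid, and $a\cdot b\le c$ iff $a\le b\to c$; $\neg a=a\to0$. $\mathbb{RL}^B$ is the class of residuated lattices expanded with a unary operation $B$ such that $Ba$ is the greatest element $b\le a$ with $b\vee\neg b=1$ (i.e. $Ba\le a$, $Ba\vee\neg Ba=1$, and $b\le Ba$ whenever $b\le a$ and $b\vee\neg b=1$). The logic $\mathrm{FL}^B_{ew}$ has binary connectives $\wedge,\vee,\cdot,\to$, constants $0,1$, and unary connective $B$; $\neg\varphi:=\varphi\to0$. Its axioms are all instances of: (1) $(\varphi\to\psi)\to((\psi\to\gamma)\to(\varphi\to\gamma))$; (2) $(\gamma\to\varphi)\to((\gamma\to\psi)\to(\gamma\to(\varphi\wedge\psi)))$; (3) $(\varphi\wedge\psi)\to\varphi$, $(\varphi\wedge\psi)\to\psi$; (4) $\varphi\to(\varphi\vee\psi)$, $\psi\to(\varphi\vee\psi)$; (5) $(\varphi\to\gamma)\to((\psi\to\gamma)\to((\varphi\vee\psi)\to\gamma))$; (6) $(\varphi\cdot\psi)\to(\psi\cdot\varphi)$;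 (7) $(\varphi\cdot\psi)\to\varphi$; (8) $(\varphi\to(\psi\to\gamma))\to((\varphi\cdot\psi)\to\gamma)$; (9) $((\varphi\cdot\psi)\to\gamma)\to(\varphi\to(\psi\to\gamma))$; (10) $0\to\varphi$, $\varphi\to1$; (B1) $B\varphi\to\varphi$; (B2) $B\varphi\vee\neg B\varphi$; (B3) $B(\varphi\vee\neg\varphi)\to(B\varphi\vee\neg\varphi)$; (B4) $B(\varphi\to\psi)\to(B\varphi\to B\psi)$. Its rules are modus ponens (from $\varphi$ and $\varphi\to\psi$ derive $\psi$) and rule (B) (from $\varphi$ derive $B\varphi$). $\Gamma\vdash\varphi$ means there is a finite derivation of $\varphi$ from premises in $\Gamma$ using the axioms and rules. An $\mathbf{A}$-evaluation is a homomorphism from the formula algebra into $\mathbf{A}$. -}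

module Defs where

open import Data.Nat using (ℕ)
open import Data.Product using (_×_)
open import Relation.Binary.Structures using (IsEquivalence)

infixr 5 _⇒_
infixl 7 _∧ᶠ_ _∨ᶠ_ _·ᶠ_

data Formula : Set where
  var   : ℕ → Formula
  _∧ᶠ_ _∨ᶠ_ _·ᶠ_ _⇒_ : Formula → Formula → Formula
  𝟘 𝟙   : Formula
  Bᶠ    : Formula → Formula

¬ᶠ_ : Formula → Formula
¬ᶠ φ = φ ⇒ 𝟘

FSet : Set₁
FSet = Formula → Set

infix 3 _⊢_

data _⊢_ (Γ : FSet) : Formula → Set where
  premise : ∀ {φ} → Γ φ → Γ ⊢ φ
  ax1  : ∀ φ ψ γ → Γ ⊢ (φ ⇒ ψ) ⇒ ((ψ ⇒ γ) ⇒ (φ ⇒ γ))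
  ax2  : ∀ φ ψ γ → Γ ⊢ (γ ⇒ φ) ⇒ ((γ ⇒ ψ) ⇒ (γ ⇒ (φ ∧ᶠ ψ)))
  ax3a : ∀ φ ψ → Γ ⊢ (φ ∧ᶠ ψ) ⇒ φ
  ax3b : ∀ φ ψ → Γ ⊢ (φ ∧ᶠ ψ) ⇒ ψ
  ax4a : ∀ φ ψ → Γ ⊢ φ ⇒ (φ ∨ᶠ ψ)
  ax4b : ∀ φ ψ → Γ ⊢ ψ ⇒ (φ ∨ᶠ ψ)
  ax5  : ∀ φ ψ γ → Γ ⊢ (φ ⇒ γ) ⇒ ((ψ ⇒ γ) ⇒ ((φ ∨ᶠ ψ) ⇒ γ))
  ax6  : ∀ φ ψ → Γ ⊢ (φ ·ᶠ ψ) ⇒ (ψ ·ᶠ φ)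
  ax7  : ∀ φ ψ → Γ ⊢ (φ ·ᶠ ψ) ⇒ φ
  ax8  : ∀ φ ψ γ → Γ ⊢ (φ ⇒ (ψ ⇒ γ)) ⇒ ((φ ·ᶠ ψ) ⇒ γ)
  ax9  : ∀ φ ψ γ → Γ ⊢ ((φ ·ᶠ ψ) ⇒ γ) ⇒ (φ ⇒ (ψ ⇒ γ))
  ax10a : ∀ φ → Γ ⊢ 𝟘 ⇒ φ
  ax10b : ∀ φ → Γ ⊢ φ ⇒ 𝟙
  axB1 : ∀ φ → Γ ⊢ Bᶠ φ ⇒ φ
  axB2 : ∀ φ → Γ ⊢ Bᶠ φ ∨ᶠ (¬ᶠ Bᶠ φ)
  axB3 : ∀ φ → Γ ⊢ Bᶠ (φ ∨ᶠ (¬ᶠ φ)) ⇒ (Bᶠ φ ∨ᶠ (¬ᶠ φ))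
  axB4 : ∀ φ ψ → Γ ⊢ Bᶠ (φ ⇒ ψ) ⇒ (Bᶠ φ ⇒ Bᶠ ψ)
  mp   : ∀ {φ ψ} → Γ ⊢ φ → Γ ⊢ φ ⇒ ψ → Γ ⊢ ψ
  ruleB : ∀ {φ} → Γ ⊢ φ → Γ ⊢ Bᶠ φ

record RLB : Set₁ where
  infix  4 _≈_ _≤_
  infixl 7 _∧_ _∨_ _·_
  infixr 5 _→ᴬ_
  field
    Carrier : Set
    _≈_     : Carrier → Carrier → Set
    isEquivalence : IsEquivalence _≈_
    _∧_ _∨_ _·_ _→ᴬ_ : Carrier → Carrier → Carrier
    0ᴬ 1ᴬ   : Carrier
    B       : Carrier → Carrier
    ∧-cong : ∀ {a a' b b'} → a ≈ a' → b ≈ b' → a ∧ b ≈ a' ∧ b'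
    ∨-cong : ∀ {a a' b b'} → a ≈ a' → b ≈ b' → a ∨ b ≈ a' ∨ b'
    ·-cong : ∀ {a a' b b'} → a ≈ a' → b ≈ b' → a · b ≈ a' · b'
    →-cong : ∀ {a a' b b'} → a ≈ a' → b ≈ b' → (a →ᴬ b) ≈ (a' →ᴬ b')
    B-cong : ∀ {a a'} → a ≈ a' → B a ≈ B a'
    ∧-assoc : ∀ a b c → (a ∧ b) ∧ c ≈ a ∧ (b ∧ c)
    ∨-assoc : ∀ a b c → (a ∨ b) ∨ c ≈ a ∨ (b ∨ c)
    ∧-comm  : ∀ a b → a ∧ b ≈ b ∧ a
    ∨-comm  : ∀ a b → a ∨ b ≈ b ∨ a
    ∧-absorbs-∨ : ∀ a b → a ∧ (a ∨ b) ≈ a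
    ∨-absorbs-∧ : ∀ a b → a ∨ (a ∧ b) ≈ a
  _≤_ : Carrier → Carrier → Set
  a ≤ b = a ∧ b ≈ a
  ¬ᴬ_ : Carrier → Carrier
  ¬ᴬ a = a →ᴬ 0ᴬ
  field
    0-least    : ∀ a → 0ᴬ ≤ a
    1-greatest : ∀ a → a ≤ 1ᴬ
    ·-assoc : ∀ a b c → (a · b) · c ≈ a · (b · c)
    ·-comm  : ∀ a b → a · b ≈ b · a
    ·-identityˡ : ∀ a → 1ᴬ · a ≈ a
    resid⇒ : ∀ a b c → a · b ≤ c → a ≤ (b →ᴬ c)
    resid⇐ : ∀ a b c → a ≤ (b →ᴬ c) → a · b ≤ c
    B-below : ∀ a → B a ≤ a
    B-compl : ∀ a → B a ∨ (¬ᴬ B a) ≈ 1ᴬ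
    B-great : ∀ a b → b ≤ a → b ∨ (¬ᴬ b) ≈ 1ᴬ → b ≤ B a

-- A-evaluations: homomorphisms Formula → A, determined by the values
-- on variables.

module _ (A : RLB) where
  open RLB A

  eval : (ℕ → Carrier) → Formula → Carrier
  eval v (var n)   = v n
  eval v (φ ∧ᶠ ψ)  = eval v φ ∧ eval v ψ
  eval v (φ ∨ᶠ ψ)  = eval v φ ∨ eval v ψ
  eval v (φ ·ᶠ ψ)  = eval v φ · eval v ψ
  eval v (φ ⇒ ψ)   = eval v φ →ᴬ eval v ψ
  eval v 𝟘         = 0ᴬ
  eval v 𝟙         = 1ᴬ
  eval v (Bᶠ φ)    = B (eval v φ)

_⊨_ : FSet → Formula → Set₁
Γ ⊨ φ = (A : RLB) → (v : ℕ → RLB.Carrier A) →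
        (∀ ψ → Γ ψ → RLB._≈_ A (eval A v ψ) (RLB.1ᴬ A)) →
        RLB._≈_ A (eval A v φ) (RLB.1ᴬ A)

-- Soundness: each axiom evaluates to 1 in every RL^B-algebra and both rules
-- preserve the value 1. For (B3) and (B4) the point is that, c being
-- complemented, c · x is again complemented as soon as c ≤ x ∨ ¬x; such a
-- product below a therefore lies below B a.
-- Completeness: the formulas, preordered by Γ ⊢ φ ⇒ ψ, form an RL^B-algebra
-- (the Lindenbaum algebra of Γ) in which the formulas of Γ evaluate to 1 and
-- every formula evaluates to itself. There B is the connective B, which is the
-- greatest complemented element below φ because (B3) turns a provable φ ∨ ¬φ
-- into φ ⇒ Bφ.
module Submission where

open import Defs
open import Data.Product using (_×_; _,_; proj₂; swap)
open import Relation.Binary.PropositionalEquality as ≡ using (_≡_; cong; cong₂; subst)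
open import Relation.Binary.Structures using (IsEquivalence)
import Algebra.Lattice.Bundles as Alg
import Algebra.Lattice.Properties.Lattice as AlgLatticeProperties
import Relation.Binary.Lattice as Ord
import Relation.Binary.Lattice.Properties.JoinSemilattice as JoinSemilatticeProperties
import Relation.Binary.Reasoning.PartialOrder as ≤-Reasoning

module RLBProperties (A : RLB) where
  open RLB A hiding (_≤_; resid⇒; resid⇐; 0-least; 1-greatest; B-below; B-great)

  lattice : Alg.Lattice _ _
  lattice = record
    { isLattice = record
      { isEquivalence = isEquivalence
      ; ∨-comm = ∨-comm ; ∨-assoc = ∨-assoc ; ∨-cong = ∨-cong
      ; ∧-comm = ∧-comm ; ∧-assoc = ∧-assoc ; ∧-cong = ∧-cong
      ; absorptive = ∨-absorbs-∧ , ∧-absorbs-∨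
      }
    }

  orderLattice : Ord.Lattice _ _ _
  orderLattice = AlgLatticeProperties.∨-∧-orderTheoreticLattice lattice

  open Ord.Lattice orderLattice public
    using (_≤_; poset; x≤x∨y; y≤x∨y; ∨-least; x∧y≤x; x∧y≤y; ∧-greatest)
    renaming (refl to ≤-refl; reflexive to ≤-reflexive; trans to ≤-trans; antisym to ≤-antisym)
  open JoinSemilatticeProperties (Ord.Lattice.joinSemilattice orderLattice) public
    using (∨-monotonic)
  open IsEquivalence isEquivalence renaming (refl to ≈-refl; sym to ≈-sym)
  open ≤-Reasoning poset

  -- The order of RLB is a ∧ b ≈ a, the library's is a ≈ a ∧ b.
  fromRLB : ∀ {a b} → RLB._≤_ A a b → a ≤ b
  fromRLB = ≈-sym

  toRLB : ∀ {a b} → a ≤ b → RLB._≤_ A a b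
  toRLB = ≈-sym

  Complemented : Carrier → Set
  Complemented c = c ∨ ¬ᴬ c ≈ 1ᴬ

  resid⇒ : ∀ {a b c} → a · b ≤ c → a ≤ (b →ᴬ c)
  resid⇒ p = fromRLB (RLB.resid⇒ A _ _ _ (toRLB p))

  resid⇐ : ∀ {a b c} → a ≤ (b →ᴬ c) → a · b ≤ c
  resid⇐ p = fromRLB (RLB.resid⇐ A _ _ _ (toRLB p))

  0≤ : ∀ {a} → 0ᴬ ≤ a
  0≤ = fromRLB (RLB.0-least A _)

  ≤1 : ∀ {a} → a ≤ 1ᴬ
  ≤1 = fromRLB (RLB.1-greatest A _)

  Ba≤a : ∀ {a} → B a ≤ a
  Ba≤a = fromRLB (RLB.B-below A _)

  B-greatest : ∀ {a b} → b ≤ a → Complemented b → b ≤ B a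
  B-greatest p k = fromRLB (RLB.B-great A _ _ (toRLB p) k)

  1≤⇒≈1 : ∀ {a} → 1ᴬ ≤ a → a ≈ 1ᴬ
  1≤⇒≈1 = ≤-antisym ≤1

  ≈1⇒1≤ : ∀ {a} → a ≈ 1ᴬ → 1ᴬ ≤ a
  ≈1⇒1≤ e = ≤-reflexive (≈-sym e)

  ·-identityʳ : ∀ a → a · 1ᴬ ≈ a
  ·-identityʳ a = begin-equality
    a · 1ᴬ  ≈⟨ ·-comm a 1ᴬ ⟩
    1ᴬ · a  ≈⟨ ·-identityˡ a ⟩
    a       ∎

  →-eval : ∀ {a b} → (a →ᴬ b) · a ≤ b
  →-eval = resid⇐ ≤-refl

  ·-monoˡ : ∀ {a b c} → a ≤ b → a · c ≤ b · c
  ·-monoˡ p = resid⇐ (≤-trans p (resid⇒ ≤-refl))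

  ·-monoʳ : ∀ {a b c} → a ≤ b → c · a ≤ c · b
  ·-monoʳ {a} {b} {c} p = begin
    c · a  ≈⟨ ·-comm c a ⟩
    a · c  ≤⟨ ·-monoˡ p ⟩
    b · c  ≈⟨ ·-comm b c ⟩
    c · b  ∎

  ·-mono : ∀ {a a′ b b′} → a ≤ a′ → b ≤ b′ → a · b ≤ a′ · b′
  ·-mono p q = ≤-trans (·-monoˡ p) (·-monoʳ q)

  x·y≤x : ∀ {a b} → a · b ≤ a
  x·y≤x {a} {b} = begin
    a · b   ≤⟨ ·-monoʳ ≤1 ⟩
    a · 1ᴬ  ≈⟨ ·-identityʳ a ⟩
    a       ∎

  x·y≤y : ∀ {a b} → a · b ≤ b
  x·y≤y {a} {b} = ≤-trans (≤-reflexive (·-comm a b)) x·y≤x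

  ·-distribˡ-∨ : ∀ {a b c} → c · (a ∨ b) ≤ (c · a) ∨ (c · b)
  ·-distribˡ-∨ {a} {b} {c} = begin
    c · (a ∨ b)  ≈⟨ ·-comm c (a ∨ b) ⟩
    (a ∨ b) · c  ≤⟨ resid⇐ (∨-least (resid⇒ (toJoin (x≤x∨y _ _))) (resid⇒ (toJoin (y≤x∨y _ _)))) ⟩
    (c · a) ∨ (c · b) ∎
    where
      toJoin : ∀ {x t} → c · x ≤ t → x · c ≤ t
      toJoin {x} p = ≤-trans (≤-reflexive (·-comm x c)) p

  →-antitoneˡ : ∀ {a a′ b} → a′ ≤ a → (a →ᴬ b) ≤ (a′ →ᴬ b)
  →-antitoneˡ p = resid⇒ (≤-trans (·-monoʳ p) →-eval)

  ¬-antitone : ∀ {a b} → a ≤ b → ¬ᴬ b ≤ ¬ᴬ a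
  ¬-antitone = →-antitoneˡ

  ≤⇒→≈1 : ∀ {a b} → a ≤ b → (a →ᴬ b) ≈ 1ᴬ
  ≤⇒→≈1 {a} p = 1≤⇒≈1 (resid⇒ (≤-trans (≤-reflexive (·-identityˡ a)) p))

  →≈1⇒≤ : ∀ {a b} → (a →ᴬ b) ≈ 1ᴬ → a ≤ b
  →≈1⇒≤ {a} e = ≤-trans (≤-reflexive (≈-sym (·-identityˡ a))) (resid⇐ (≈1⇒1≤ e))

  →-compose : ∀ {a b c} → (a →ᴬ b) · (b →ᴬ c) ≤ (a →ᴬ c)
  →-compose {a} {b} {c} = resid⇒ (begin
    ((a →ᴬ b) · (b →ᴬ c)) · a  ≈⟨ ·-cong (·-comm _ _) ≈-refl ⟩
    ((b →ᴬ c) · (a →ᴬ b)) · a  ≈⟨ ·-assoc _ _ _ ⟩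
    (b →ᴬ c) · ((a →ᴬ b) · a)  ≤⟨ ·-monoʳ →-eval ⟩
    (b →ᴬ c) · b               ≤⟨ →-eval ⟩
    c                          ∎)

  →-∧-intro : ∀ {a b c} → (c →ᴬ a) · (c →ᴬ b) ≤ (c →ᴬ a ∧ b)
  →-∧-intro = resid⇒ (∧-greatest (≤-trans (·-monoˡ x·y≤x) →-eval)
                                 (≤-trans (·-monoˡ x·y≤y) →-eval))

  →-∨-elim : ∀ {a b c} → (a →ᴬ c) · (b →ᴬ c) ≤ (a ∨ b →ᴬ c)
  →-∨-elim = resid⇒ (≤-trans ·-distribˡ-∨
               (∨-least (≤-trans (·-monoˡ x·y≤x) →-eval)
                        (≤-trans (·-monoˡ x·y≤y) →-eval)))

  →-uncurry : ∀ {a b c} → (a →ᴬ (b →ᴬ c)) ≤ (a · b →ᴬ c)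
  →-uncurry {a} {b} {c} = resid⇒ (begin
    (a →ᴬ (b →ᴬ c)) · (a · b)  ≈⟨ ·-assoc _ _ _ ⟨
    ((a →ᴬ (b →ᴬ c)) · a) · b  ≤⟨ ·-monoˡ →-eval ⟩
    (b →ᴬ c) · b               ≤⟨ →-eval ⟩
    c                          ∎)

  →-curry : ∀ {a b c} → (a · b →ᴬ c) ≤ (a →ᴬ (b →ᴬ c))
  →-curry = resid⇒ (resid⇒ (≤-trans (≤-reflexive (·-assoc _ _ _)) →-eval))

  1-complemented : Complemented 1ᴬ
  1-complemented = 1≤⇒≈1 (x≤x∨y _ _)

  complemented⇒≤· : ∀ {c x} → Complemented c → c ≤ x → c ≤ c · x
  complemented⇒≤· {c} {x} k p = begin
    c                    ≈⟨ ·-identityʳ c ⟨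
    c · 1ᴬ               ≈⟨ ·-cong ≈-refl k ⟨
    c · (c ∨ ¬ᴬ c)       ≤⟨ ·-distribˡ-∨ ⟩
    (c · c) ∨ (c · ¬ᴬ c) ≤⟨ ∨-least (·-monoʳ p) c·¬c≤c·x ⟩
    c · x                ∎
    where
      c·¬c≤c·x : c · ¬ᴬ c ≤ c · x
      c·¬c≤c·x = ≤-trans (≤-reflexive (·-comm c _)) (≤-trans →-eval 0≤)

  ·-complemented : ∀ {c x} → Complemented c → c ≤ x ∨ ¬ᴬ x → Complemented (c · x)
  ·-complemented {c} {x} k p = 1≤⇒≈1 (begin
    1ᴬ                    ≈⟨ k ⟨
    c ∨ ¬ᴬ c              ≤⟨ ∨-least c≤ (≤-trans (¬-antitone x·y≤x) (y≤x∨y _ _)) ⟩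
    (c · x) ∨ ¬ᴬ (c · x)  ∎)
    where
      c≤ : c ≤ (c · x) ∨ ¬ᴬ (c · x)
      c≤ = begin
        c                     ≤⟨ complemented⇒≤· k p ⟩
        c · (x ∨ ¬ᴬ x)        ≤⟨ ·-distribˡ-∨ ⟩
        (c · x) ∨ (c · ¬ᴬ x)  ≤⟨ ∨-monotonic ≤-refl (≤-trans x·y≤y (¬-antitone x·y≤y)) ⟩
        (c · x) ∨ ¬ᴬ (c · x)  ∎

  B1≈1 : B 1ᴬ ≈ 1ᴬ
  B1≈1 = 1≤⇒≈1 (B-greatest ≤-refl 1-complemented)

  B-→-distrib : ∀ {a b} → B (a →ᴬ b) ≤ (B a →ᴬ B b)
  B-→-distrib {a} = resid⇒ (B-greatest (≤-trans (·-mono Ba≤a Ba≤a) →-eval)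
                                       (·-complemented (B-compl _) (≤-trans ≤1 (≈1⇒1≤ (B-compl a)))))

  B-excluded-middle : ∀ {a} → B (a ∨ ¬ᴬ a) ≤ B a ∨ ¬ᴬ a
  B-excluded-middle {a} = begin
    c                     ≤⟨ complemented⇒≤· (B-compl _) Ba≤a ⟩
    c · (a ∨ ¬ᴬ a)        ≤⟨ ·-distribˡ-∨ ⟩
    (c · a) ∨ (c · ¬ᴬ a)  ≤⟨ ∨-monotonic (B-greatest x·y≤y (·-complemented (B-compl _) Ba≤a)) x·y≤y ⟩
    B a ∨ ¬ᴬ a            ∎
    where c = B (a ∨ ¬ᴬ a)

soundness : ∀ {Γ φ} → Γ ⊢ φ → Γ ⊨ φ
soundness {Γ} d A v Γ≈1 = sound d
  where
    open RLB A using (_≈_; 1ᴬ; B-compl; B-cong; ·-comm)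
    open RLBProperties A
    open IsEquivalence (RLB.isEquivalence A) using (trans)

    ⟦_⟧ : Formula → RLB.Carrier A
    ⟦_⟧ = eval A v

    sound : ∀ {φ} → Γ ⊢ φ → ⟦ φ ⟧ ≈ 1ᴬ
    sound (premise {φ} φ∈Γ) = Γ≈1 φ φ∈Γ
    sound (ax1 φ ψ γ)  = ≤⇒→≈1 (resid⇒ →-compose)
    sound (ax2 φ ψ γ)  = ≤⇒→≈1 (resid⇒ →-∧-intro)
    sound (ax3a φ ψ)   = ≤⇒→≈1 (x∧y≤x _ _)
    sound (ax3b φ ψ)   = ≤⇒→≈1 (x∧y≤y _ _)
    sound (ax4a φ ψ)   = ≤⇒→≈1 (x≤x∨y _ _)
    sound (ax4b φ ψ)   = ≤⇒→≈1 (y≤x∨y _ _)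
    sound (ax5 φ ψ γ)  = ≤⇒→≈1 (resid⇒ →-∨-elim)
    sound (ax6 φ ψ)    = ≤⇒→≈1 (≤-reflexive (·-comm _ _))
    sound (ax7 φ ψ)    = ≤⇒→≈1 x·y≤x
    sound (ax8 φ ψ γ)  = ≤⇒→≈1 →-uncurry
    sound (ax9 φ ψ γ)  = ≤⇒→≈1 →-curry
    sound (ax10a φ)    = ≤⇒→≈1 0≤
    sound (ax10b φ)    = ≤⇒→≈1 ≤1
    sound (axB1 φ)     = ≤⇒→≈1 Ba≤a
    sound (axB2 φ)     = B-compl _
    sound (axB3 φ)     = ≤⇒→≈1 B-excluded-middle
    sound (axB4 φ ψ)   = ≤⇒→≈1 B-→-distrib
    sound (mp d d⇒)    = 1≤⇒≈1 (≤-trans (≈1⇒1≤ (sound d)) (→≈1⇒≤ (sound d⇒)))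
    sound (ruleB d)    = trans (B-cong (sound d)) B1≈1

module Lindenbaum (Γ : FSet) where

  ⇒-trans : ∀ {a b c} → Γ ⊢ a ⇒ b → Γ ⊢ b ⇒ c → Γ ⊢ a ⇒ c
  ⇒-trans {a} {b} {c} p q = mp q (mp p (ax1 a b c))

  curry : ∀ {a b c} → Γ ⊢ a ·ᶠ b ⇒ c → Γ ⊢ a ⇒ (b ⇒ c)
  curry {a} {b} {c} p = mp p (ax9 a b c)

  uncurry : ∀ {a b c} → Γ ⊢ a ⇒ (b ⇒ c) → Γ ⊢ a ·ᶠ b ⇒ c
  uncurry {a} {b} {c} p = mp p (ax8 a b c)

  ⇒-refl : ∀ a → Γ ⊢ a ⇒ a
  ⇒-refl a = mp (ax10a 𝟘) (curry (⇒-trans (ax6 (𝟘 ⇒ 𝟘) a) (ax7 a (𝟘 ⇒ 𝟘))))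

  ⊢𝟙 : Γ ⊢ 𝟙
  ⊢𝟙 = mp (⇒-refl 𝟙) (ax10b (𝟙 ⇒ 𝟙))

  weaken : ∀ {a} b → Γ ⊢ a → Γ ⊢ b ⇒ a
  weaken {a} b p = mp p (curry (ax7 a b))

  exchange : ∀ {a b c} → Γ ⊢ a ⇒ (b ⇒ c) → Γ ⊢ b ⇒ (a ⇒ c)
  exchange {a} {b} p = curry (⇒-trans (ax6 b a) (uncurry p))

  ∧-intro : ∀ {a b c} → Γ ⊢ c ⇒ a → Γ ⊢ c ⇒ b → Γ ⊢ c ⇒ a ∧ᶠ b
  ∧-intro {a} {b} {c} p q = mp q (mp p (ax2 a b c))

  ∨-elim : ∀ {a b c} → Γ ⊢ a ⇒ c → Γ ⊢ b ⇒ c → Γ ⊢ a ∨ᶠ b ⇒ c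
  ∨-elim {a} {b} {c} p q = mp q (mp p (ax5 a b c))

  ∧-mono : ∀ {a a′ b b′} → Γ ⊢ a ⇒ a′ → Γ ⊢ b ⇒ b′ → Γ ⊢ a ∧ᶠ b ⇒ a′ ∧ᶠ b′
  ∧-mono p q = ∧-intro (⇒-trans (ax3a _ _) p) (⇒-trans (ax3b _ _) q)

  ∨-mono : ∀ {a a′ b b′} → Γ ⊢ a ⇒ a′ → Γ ⊢ b ⇒ b′ → Γ ⊢ a ∨ᶠ b ⇒ a′ ∨ᶠ b′
  ∨-mono p q = ∨-elim (⇒-trans p (ax4a _ _)) (⇒-trans q (ax4b _ _))

  ·-monoˡ : ∀ {a a′} b → Γ ⊢ a ⇒ a′ → Γ ⊢ a ·ᶠ b ⇒ a′ ·ᶠ b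
  ·-monoˡ {a′ = a′} b p = uncurry (⇒-trans p (curry (⇒-refl (a′ ·ᶠ b))))

  ·-mono : ∀ {a a′ b b′} → Γ ⊢ a ⇒ a′ → Γ ⊢ b ⇒ b′ → Γ ⊢ a ·ᶠ b ⇒ a′ ·ᶠ b′
  ·-mono {a′ = a′} {b} p q =
    ⇒-trans (·-monoˡ b p) (⇒-trans (ax6 a′ b) (⇒-trans (·-monoˡ a′ q) (ax6 _ a′)))

  ⇒-mono : ∀ {a a′ b b′} → Γ ⊢ a′ ⇒ a → Γ ⊢ b ⇒ b′ → Γ ⊢ (a ⇒ b) ⇒ (a′ ⇒ b′)
  ⇒-mono {a} {a′} {b} {b′} p q = ⇒-trans (mp p (ax1 a′ a b)) (mp q (exchange (ax1 a′ b b′)))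

  B-mono : ∀ {a b} → Γ ⊢ a ⇒ b → Γ ⊢ Bᶠ a ⇒ Bᶠ b
  B-mono {a} {b} p = mp (ruleB p) (axB4 a b)

  ·-assocʳ : ∀ a b c → Γ ⊢ (a ·ᶠ b) ·ᶠ c ⇒ a ·ᶠ (b ·ᶠ c)
  ·-assocʳ a b c = uncurry (uncurry (⇒-trans (curry (⇒-refl (a ·ᶠ (b ·ᶠ c)))) (ax9 b c _)))

  ·-assocˡ : ∀ a b c → Γ ⊢ a ·ᶠ (b ·ᶠ c) ⇒ (a ·ᶠ b) ·ᶠ c
  ·-assocˡ a b c =
    ⇒-trans (ax6 a _) (⇒-trans (·-assocʳ b c a) (⇒-trans (ax6 b _)
      (⇒-trans (·-assocʳ c a b) (ax6 c _))))

  decided⇒B : ∀ {b} → Γ ⊢ b ∨ᶠ ¬ᶠ b → Γ ⊢ b ⇒ Bᶠ b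
  decided⇒B {b} p = mp (mp (ruleB p) (axB3 b))
                       (∨-elim (curry (ax7 (Bᶠ b) b)) (mp (ax10a (Bᶠ b)) (exchange (ax1 b 𝟘 (Bᶠ b)))))

  infix 4 _⊣⊢_
  _⊣⊢_ : Formula → Formula → Set
  a ⊣⊢ b = (Γ ⊢ a ⇒ b) × (Γ ⊢ b ⇒ a)

  ⊢⇒⊣⊢𝟙 : ∀ {a} → Γ ⊢ a → a ⊣⊢ 𝟙
  ⊢⇒⊣⊢𝟙 {a} p = ax10b a , weaken 𝟙 p

  ⊣⊢𝟙⇒⊢ : ∀ {a} → a ⊣⊢ 𝟙 → Γ ⊢ a
  ⊣⊢𝟙⇒⊢ e = mp ⊢𝟙 (proj₂ e)

  ⇒-to-≤ : ∀ {a b} → Γ ⊢ a ⇒ b → a ∧ᶠ b ⊣⊢ a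
  ⇒-to-≤ {a} {b} p = ax3a a b , ∧-intro (⇒-refl a) p

  ≤-to-⇒ : ∀ {a b} → a ∧ᶠ b ⊣⊢ a → Γ ⊢ a ⇒ b
  ≤-to-⇒ {a} {b} e = ⇒-trans (proj₂ e) (ax3b a b)

  lindenbaum : RLB
  lindenbaum = record
    { Carrier = Formula
    ; _≈_ = _⊣⊢_
    ; isEquivalence = record
        { refl = ⇒-refl _ , ⇒-refl _
        ; sym = swap
        ; trans = λ (p , p′) (q , q′) → ⇒-trans p q , ⇒-trans q′ p′
        }
    ; _∧_ = _∧ᶠ_ ; _∨_ = _∨ᶠ_ ; _·_ = _·ᶠ_ ; _→ᴬ_ = _⇒_
    ; 0ᴬ = 𝟘 ; 1ᴬ = 𝟙 ; B = Bᶠ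
    ; ∧-cong = λ (p , p′) (q , q′) → ∧-mono p q , ∧-mono p′ q′
    ; ∨-cong = λ (p , p′) (q , q′) → ∨-mono p q , ∨-mono p′ q′
    ; ·-cong = λ (p , p′) (q , q′) → ·-mono p q , ·-mono p′ q′
    ; →-cong = λ (p , p′) (q , q′) → ⇒-mono p′ q , ⇒-mono p q′
    ; B-cong = λ (p , p′) → B-mono p , B-mono p′
    ; ∧-assoc = λ _ _ _ →
        ∧-intro (⇒-trans (ax3a _ _) (ax3a _ _)) (∧-mono (ax3b _ _) (⇒-refl _))
      , ∧-intro (∧-mono (⇒-refl _) (ax3a _ _)) (⇒-trans (ax3b _ _) (ax3b _ _))
    ; ∨-assoc = λ _ _ _ →
        ∨-elim (∨-mono (⇒-refl _) (ax4a _ _)) (⇒-trans (ax4b _ _) (ax4b _ _))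
      , ∨-elim (⇒-trans (ax4a _ _) (ax4a _ _)) (∨-mono (ax4b _ _) (⇒-refl _))
    ; ∧-comm = λ _ _ → ∧-intro (ax3b _ _) (ax3a _ _) , ∧-intro (ax3b _ _) (ax3a _ _)
    ; ∨-comm = λ _ _ → ∨-elim (ax4b _ _) (ax4a _ _) , ∨-elim (ax4b _ _) (ax4a _ _)
    ; ∧-absorbs-∨ = λ a b → ax3a _ _ , ∧-intro (⇒-refl a) (ax4a a b)
    ; ∨-absorbs-∧ = λ a b → ∨-elim (⇒-refl a) (ax3a a b) , ax4a _ _
    ; 0-least = λ a → ⇒-to-≤ (ax10a a)
    ; 1-greatest = λ a → ⇒-to-≤ (ax10b a)
    ; ·-assoc = λ a b c → ·-assocʳ a b c , ·-assocˡ a b c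
    ; ·-comm = λ a b → ax6 a b , ax6 b a
    ; ·-identityˡ = λ a → ⇒-trans (ax6 𝟙 a) (ax7 a 𝟙) , mp ⊢𝟙 (curry (⇒-refl (𝟙 ·ᶠ a)))
    ; resid⇒ = λ _ _ _ e → ⇒-to-≤ (curry (≤-to-⇒ e))
    ; resid⇐ = λ _ _ _ e → ⇒-to-≤ (uncurry (≤-to-⇒ e))
    ; B-below = λ a → ⇒-to-≤ (axB1 a)
    ; B-compl = λ a → ⊢⇒⊣⊢𝟙 (axB2 a)
    ; B-great = λ _ _ b≤a k → ⇒-to-≤ (⇒-trans (decided⇒B (⊣⊢𝟙⇒⊢ k)) (B-mono (≤-to-⇒ b≤a)))
    }

  eval-var : ∀ φ → eval lindenbaum var φ ≡ φ
  eval-var (var n)  = ≡.refl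
  eval-var (φ ∧ᶠ ψ) = cong₂ _∧ᶠ_ (eval-var φ) (eval-var ψ)
  eval-var (φ ∨ᶠ ψ) = cong₂ _∨ᶠ_ (eval-var φ) (eval-var ψ)
  eval-var (φ ·ᶠ ψ) = cong₂ _·ᶠ_ (eval-var φ) (eval-var ψ)
  eval-var (φ ⇒ ψ)  = cong₂ _⇒_ (eval-var φ) (eval-var ψ)
  eval-var 𝟘        = ≡.refl
  eval-var 𝟙        = ≡.refl
  eval-var (Bᶠ φ)   = cong Bᶠ (eval-var φ)

  completeness : ∀ {φ} → Γ ⊨ φ → Γ ⊢ φ
  completeness {φ} ⊨φ = ⊣⊢𝟙⇒⊢ (subst (_⊣⊢ 𝟙) (eval-var φ) (⊨φ lindenbaum var Γ≈𝟙))
    where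
      Γ≈𝟙 : ∀ ψ → Γ ψ → eval lindenbaum var ψ ⊣⊢ 𝟙
      Γ≈𝟙 ψ ψ∈Γ = subst (_⊣⊢ 𝟙) (≡.sym (eval-var ψ)) (⊢⇒⊣⊢𝟙 (premise ψ∈Γ))

theorem2 : (Γ : FSet) (φ : Formula) → ((Γ ⊢ φ) → (Γ ⊨ φ)) × ((Γ ⊨ φ) → (Γ ⊢ φ))
theorem2 Γ φ = soundness , Lindenbaum.completeness Γ
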